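{- Let $n,k$ be positive integers with $n>2k$ and $\gcd(n,k)=1$. Then every vertex of $Q(n,k)$ has degree $n-2k+1$.
   Context: For a positive integer $n$ let $[n]=\{1,\dots,n\}$ and let $C_n$ be the cycle on $[n]$ with edges $\{i,i+1\}$ ($1\le i\le n-1$) and $\{n,1\}$. The Schrijver graph $\mathrm{SG}(n,k)$ ($n\ge 2k$) has as vertices the $k$-subsets of $[n]$ containing no two cyclically consecutive elements, two vertices adjacent iff they are disjoint. An arc of $C_n$ is a set $\{i,i+1,\dots,i+m-1\}$ (addition mod $n$) with $1\le m\le n-1$. A set $U\subseteq[n]$ is well-spread if for any two arcs $A,B$ with $|A|=|B|$ we have $\big||A\cap U|-|B\cap U|\big|\le 1$. $Q(n,k)$ is the induced subgraph of $\mathrm{SG}(n,k)$ on all well-spread $k$-subsets of $[n]$. -}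

module Defs where

open import Data.Bool using (Bool; true; false; _∧_; not)
open import Data.Nat using (ℕ; zero; suc; _+_; _∸_; _<_; _≤ᵇ_; ∣_-_∣)
open import Data.Nat.DivMod using (_%_; m%n<n)
open import Data.Fin using (Fin; fromℕ<)
open import Data.Vec using (Vec; []; _∷_; lookup)
open import Data.List using (List; []; _∷_; map; _++_; upTo; length; filterᵇ)
open import Data.Bool.ListAction using (and)
open import Data.Fin.Subset using (Subset; ∣_∣) public

-- Convention: the ground set [n] = {1,…,n} is represented by positions
-- 0,…,n-1 (element i+1 ↦ position i); a subset of [n] is a 'Subset n'
-- (a Vec Bool n, true = member).  The cyclic structure of C_n is index
-- arithmetic mod n.

_∋ᶜ_ : {n : ℕ} → Subset n → ℕ → Bool
_∋ᶜ_ {zero}  U i = false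
_∋ᶜ_ {suc m} U i = lookup U (fromℕ< (m%n<n i (suc m)))

allᵇ : {A : Set} → List A → (A → Bool) → Bool
allᵇ xs p = and (map p xs)

hasSizeᵇ : {n : ℕ} → ℕ → Subset n → Bool
hasSizeᵇ k U = ∣ U ∣ Data.Nat.≡ᵇ k

stableᵇ : {n : ℕ} → Subset n → Bool
stableᵇ {n} U = allᵇ (upTo n) (λ i → not ((U ∋ᶜ i) ∧ (U ∋ᶜ (i + 1))))

arcCount : {n : ℕ} → Subset n → ℕ → ℕ → ℕ
arcCount U i zero    = 0
arcCount U i (suc m) = (if′ (U ∋ᶜ i)) + arcCount U (suc i) m
  where
  if′ : Bool → ℕ
  if′ true  = 1
  if′ false = 0

-- well-spread: for any two arcs A, B of the same length m (1 ≤ m ≤ n-1),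
-- ||A ∩ U| - |B ∩ U|| ≤ 1.  Arcs of length m are exactly the sets
-- {i,…,i+m-1} mod n with starting point i ∈ {0,…,n-1}.
wellSpreadᵇ : {n : ℕ} → Subset n → Bool
wellSpreadᵇ {n} U =
  allᵇ (map suc (upTo (n ∸ 1))) λ m →
  allᵇ (upTo n) λ i →
  allᵇ (upTo n) λ j →
  ∣ arcCount U i m - arcCount U j m ∣ ≤ᵇ 1

-- U is a vertex of Q(n,k): a well-spread vertex of SG(n,k)
isQVertexᵇ : (n k : ℕ) → Subset n → Bool
isQVertexᵇ n k U = hasSizeᵇ k U ∧ stableᵇ U ∧ wellSpreadᵇ U

disjointᵇ : {n : ℕ} → Subset n → Subset n → Bool
disjointᵇ {n} U V = allᵇ (upTo n) (λ i → not ((U ∋ᶜ i) ∧ (V ∋ᶜ i)))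

allSubsets : (n : ℕ) → List (Subset n)
allSubsets zero    = [] ∷ []
allSubsets (suc n) = map (true ∷_) (allSubsets n) ++ map (false ∷_) (allSubsets n)

-- degree of U in Q(n,k): number of vertices V of Q(n,k) disjoint from U
-- (U itself is never counted when U is nonempty, since U ∩ U = U ≠ ∅).
degreeQ : (n k : ℕ) → Subset n → ℕ
degreeQ n k U = length (filterᵇ (λ V → isQVertexᵇ n k V ∧ disjointᵇ U V) (allSubsets n))

{-# OPTIONS --safe #-}
-- Because gcd(n, k) = 1, the well-spread k-sets are exactly the n rotations
-- W t = {i : (i k + t) mod n ≥ n − k} of one evenly spaced set.  For a well-spread U
-- with counting function φ(i) = |U ∩ [0, i)|, the n arcs of length m hold m k points
-- in total and differ by at most one point, and n ∤ m k makes each arc count strictly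
-- between m k / n − 1 and m k / n + 1.  Hence n φ(i) − i k takes values in a window
-- (M − n, M], i.e. φ(i) = ⌊(i k + M)/n⌋ and U = W M.  As multiplication by k permutes
-- the residues mod n, W M and W (M + d) are disjoint iff the window [n − k, n) and its
-- translate by d are, i.e. iff k ≤ d ≤ n − k; these n − 2k + 1 translates are distinct.
module Submission where

open import Defs
open import Data.Bool using (Bool; true; false; _∧_; not; T)
open import Data.Empty using (⊥-elim)
open import Data.Bool.Properties using (∧-conicalˡ; ∧-conicalʳ; T-≡)
open import Data.Nat
open import Data.Nat.Properties
open import Data.Nat.DivMod
open import Data.Nat.Divisibility using (_∣_; ∣⇒≤; divides)
open import Data.Nat.Coprimality using (Coprime; coprime-divisor; coprime-Bézout; gcd≡1⇒coprime)
open import Data.Nat.GCD using (gcd; module Bézout)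
open import Data.Fin using (Fin; toℕ; fromℕ<)
open import Data.Fin.Properties using (fromℕ<-cong; fromℕ<-toℕ; toℕ<n; toℕ-fromℕ<)
open import Data.Vec using ([]; _∷_; tabulate)
import Data.Vec as Vec
open import Data.Vec.Properties using (lookup∘tabulate; tabulate∘lookup; tabulate-cong; ∷-injectiveʳ)
open import Data.List using (List; []; _∷_; _++_; map; upTo; applyUpTo; length; filterᵇ)
open import Data.List.Properties using (length-++; length-applyUpTo)
open import Data.List.Relation.Binary.Subset.Propositional using (_⊆_)
open import Data.List.Relation.Unary.AllPairs using ([]; _∷_)
open import Data.List.Relation.Unary.Unique.Propositional using (Unique)
import Data.List.Relation.Unary.Unique.Propositional.Properties as Unique
open import Data.List.Membership.Propositional.Properties
  using (∈-map⁺; ∈-map⁻; ∈-upTo⁺; ∈-++⁺ˡ; ∈-++⁺ʳ; ∈-++⁻; ∈-∃++;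
         ∈-applyUpTo⁺; ∈-applyUpTo⁻; ∈-filter⁺; ∈-filter⁻)
open import Data.List.Membership.Propositional using (_∈_)
import Data.List.Relation.Unary.All as All
import Data.List.Relation.Unary.All.Properties as All
open import Data.List.Relation.Unary.Any using (here; there)
open import Data.Product using (∃; _×_; _,_; proj₁; proj₂)
open import Data.Sum using (_⊎_; inj₁; inj₂)
open import Function using (_∘_; Equivalence)
open import Relation.Nullary using (¬_; yes; no; contradiction)
open import Relation.Nullary.Decidable using (T?)
open import Relation.Binary.PropositionalEquality
open import Relation.Binary.Definitions using (tri<; tri≈; tri>)
open import Data.Nat.Tactic.RingSolver using (solve-∀)

bit : Bool → ℕ
bit true  = 1
bit false = 0

bit-injective : ∀ {a b} → bit a ≡ bit b → a ≡ b
bit-injective {true}  {true}  _ = refl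
bit-injective {false} {false} _ = refl

∣bit-bit∣≤1 : ∀ a b → ∣ bit a - bit b ∣ ≤ 1
∣bit-bit∣≤1 true  true  = z≤n
∣bit-bit∣≤1 true  false = s≤s z≤n
∣bit-bit∣≤1 false true  = s≤s z≤n
∣bit-bit∣≤1 false false = z≤n

∧-intro : ∀ {a b} → a ≡ true → b ≡ true → a ∧ b ≡ true
∧-intro refl refl = refl

T⇒≡true : ∀ {b} → T b → b ≡ true
T⇒≡true = Equivalence.to T-≡

≡true⇒T : ∀ {b} → b ≡ true → T b
≡true⇒T = Equivalence.from T-≡

allᵇ⁻ : ∀ {A : Set} (xs : List A) (p : A → Bool) → allᵇ xs p ≡ true → ∀ {x} → x ∈ xs → p x ≡ true
allᵇ⁻ xs p h x∈ = T⇒≡true (All.lookup (All.all⁺ p xs (≡true⇒T h)) x∈)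

allᵇ⁺ : ∀ {A : Set} (xs : List A) (p : A → Bool) → (∀ {x} → x ∈ xs → p x ≡ true) → allᵇ xs p ≡ true
allᵇ⁺ xs p h = T⇒≡true (All.all⁻ p (All.tabulate (≡true⇒T ∘ h)))

≤ᵇ-true⁻ : ∀ {a b} → (a ≤ᵇ b) ≡ true → a ≤ b
≤ᵇ-true⁻ {a} {b} h = ≤ᵇ⇒≤ a b (≡true⇒T h)

≤ᵇ-true : ∀ {a b} → a ≤ b → (a ≤ᵇ b) ≡ true
≤ᵇ-true h = T⇒≡true (≤⇒≤ᵇ h)

≤ᵇ-false : ∀ {a b} → b < a → (a ≤ᵇ b) ≡ false
≤ᵇ-false {a} {b} h with a ≤ᵇ b in eq
... | false = refl
... | true  = contradiction (≤ᵇ-true⁻ eq) (<⇒≱ h)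

-- Sums over intervals

sumFrom : (ℕ → ℕ) → ℕ → ℕ → ℕ
sumFrom g i zero    = 0
sumFrom g i (suc m) = g i + sumFrom g (suc i) m

countFrom : (ℕ → Bool) → ℕ → ℕ → ℕ
countFrom f = sumFrom (bit ∘ f)

arcCount≡countFrom : ∀ {n} (U : Subset n) i m → arcCount U i m ≡ countFrom (U ∋ᶜ_) i m
arcCount≡countFrom U i zero = refl
arcCount≡countFrom U i (suc m) with U ∋ᶜ i
... | true  = cong suc (arcCount≡countFrom U (suc i) m)
... | false = arcCount≡countFrom U (suc i) m

sumFrom-+ : ∀ g i a b → sumFrom g i (a + b) ≡ sumFrom g i a + sumFrom g (i + a) b
sumFrom-+ g i zero    b = cong (λ j → sumFrom g j b) (sym (+-identityʳ i))
sumFrom-+ g i (suc a) b = begin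
    g i + sumFrom g (suc i) (a + b)
  ≡⟨ cong (g i +_) (sumFrom-+ g (suc i) a b) ⟩
    g i + (sumFrom g (suc i) a + sumFrom g (suc i + a) b)
  ≡⟨ sym (+-assoc (g i) _ _) ⟩
    g i + sumFrom g (suc i) a + sumFrom g (suc i + a) b
  ≡⟨ cong (λ j → g i + sumFrom g (suc i) a + sumFrom g j b) (sym (+-suc i a)) ⟩
    g i + sumFrom g (suc i) a + sumFrom g (i + suc a) b ∎
  where open ≡-Reasoning

sumFrom-last : ∀ g i m → sumFrom g i (suc m) ≡ sumFrom g i m + g (i + m)
sumFrom-last g i m = begin
  sumFrom g i (suc m)            ≡⟨ cong (sumFrom g i) (+-comm 1 m) ⟩
  sumFrom g i (m + 1)            ≡⟨ sumFrom-+ g i m 1 ⟩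
  sumFrom g i m + (g (i + m) + 0) ≡⟨ cong (sumFrom g i m +_) (+-identityʳ _) ⟩
  sumFrom g i m + g (i + m)      ∎
  where open ≡-Reasoning

sumFrom-cong : ∀ {g h} → (∀ j → g j ≡ h j) → ∀ i m → sumFrom g i m ≡ sumFrom h i m
sumFrom-cong e i zero    = refl
sumFrom-cong e i (suc m) = cong₂ _+_ (e i) (sumFrom-cong e (suc i) m)

sumFrom-distrib-+ : ∀ g h i m → sumFrom (λ j → g j + h j) i m ≡ sumFrom g i m + sumFrom h i m
sumFrom-distrib-+ g h i zero    = refl
sumFrom-distrib-+ g h i (suc m) =
  trans (cong (g i + h i +_) (sumFrom-distrib-+ g h (suc i) m)) (interchange (g i) (h i) _ _)
  where
  interchange : ∀ a b c d → a + b + (c + d) ≡ a + c + (b + d)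
  interchange = solve-∀

sumFrom-zero : ∀ i m → sumFrom (λ _ → 0) i m ≡ 0
sumFrom-zero i zero    = refl
sumFrom-zero i (suc m) = sumFrom-zero (suc i) m

sumFrom-shift : ∀ g c i m → sumFrom (λ j → g (j + c)) i m ≡ sumFrom g (i + c) m
sumFrom-shift g c i zero    = refl
sumFrom-shift g c i (suc m) = cong (g (i + c) +_) (sumFrom-shift g c (suc i) m)

sumFrom-periodic : ∀ g N → (∀ j → g (j + N) ≡ g j) → ∀ i → sumFrom g i N ≡ sumFrom g 0 N
sumFrom-periodic g N per zero    = refl
sumFrom-periodic g N per (suc i) = trans step (sumFrom-periodic g N per i)
  where
  step : sumFrom g (suc i) N ≡ sumFrom g i N
  step = +-cancelˡ-≡ (g i) _ _ (begin
    sumFrom g i (suc N)       ≡⟨ sumFrom-last g i N ⟩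
    sumFrom g i N + g (i + N) ≡⟨ cong (sumFrom g i N +_) (per i) ⟩
    sumFrom g i N + g i       ≡⟨ +-comm (sumFrom g i N) (g i) ⟩
    g i + sumFrom g i N       ∎)
    where open ≡-Reasoning

-- Each point lies in exactly m of the N arcs of length m.
sumFrom-countFrom : ∀ f N → (∀ j → f (j + N) ≡ f j) → ∀ m →
                    sumFrom (λ i → countFrom f i m) 0 N ≡ m * countFrom f 0 N
sumFrom-countFrom f N per zero    = sumFrom-zero 0 N
sumFrom-countFrom f N per (suc m) = begin
    sumFrom (λ i → countFrom f i (suc m)) 0 N
  ≡⟨ sumFrom-cong (λ i → sumFrom-last (bit ∘ f) i m) 0 N ⟩
    sumFrom (λ i → countFrom f i m + bit (f (i + m))) 0 N
  ≡⟨ sumFrom-distrib-+ _ _ 0 N ⟩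
    sumFrom (λ i → countFrom f i m) 0 N + sumFrom (λ i → bit (f (i + m))) 0 N
  ≡⟨ cong₂ _+_ (sumFrom-countFrom f N per m) (trans (sumFrom-shift (bit ∘ f) m 0 N)
       (sumFrom-periodic (bit ∘ f) N (cong bit ∘ per) m)) ⟩
    m * countFrom f 0 N + countFrom f 0 N
  ≡⟨ +-comm (m * countFrom f 0 N) _ ⟩
    suc m * countFrom f 0 N ∎
  where open ≡-Reasoning

sumFrom-≤ : ∀ g c i m → (∀ j → j < i + m → g j ≤ c) → sumFrom g i m ≤ m * c
sumFrom-≤ g c i zero    h = z≤n
sumFrom-≤ g c i (suc m) h =
  +-mono-≤ (h i (m<m+n i z<s)) (sumFrom-≤ g c (suc i) m (λ j j< → h j (subst (j <_) (sym (+-suc i m)) j<)))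

sumFrom-≥ : ∀ g c i m → (∀ j → j < i + m → c ≤ g j + 1) → m * c ≤ sumFrom g i m + m
sumFrom-≥ g c i zero    h = z≤n
sumFrom-≥ g c i (suc m) h = begin
    c + m * c
  ≤⟨ +-mono-≤ (h i (m<m+n i z<s))
       (sumFrom-≥ g c (suc i) m (λ j j< → h j (subst (j <_) (sym (+-suc i m)) j<))) ⟩
    g i + 1 + (sumFrom g (suc i) m + m)
  ≡⟨ rearrange (g i) (sumFrom g (suc i) m) m ⟩
    g i + sumFrom g (suc i) m + suc m ∎
  where
  open ≤-Reasoning
  rearrange : ∀ a b m → a + 1 + (b + m) ≡ a + b + suc m
  rearrange = solve-∀

module _ {p : ℕ} where

  ∋ᶜ-toℕ : (U : Subset (suc p)) (f : Fin (suc p)) → U ∋ᶜ toℕ f ≡ Vec.lookup U f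
  ∋ᶜ-toℕ U f = cong (Vec.lookup U)
    (trans (fromℕ<-cong _ _ (m<n⇒m%n≡m (toℕ<n f)) _ (toℕ<n f)) (fromℕ<-toℕ f (toℕ<n f)))

  ∋ᶜ-periodic : (U : Subset (suc p)) (i : ℕ) → U ∋ᶜ (i + suc p) ≡ U ∋ᶜ i
  ∋ᶜ-periodic U i = cong (Vec.lookup U) (fromℕ<-cong _ _ ([m+n]%n≡m%n i (suc p)) _ _)

∣∷∣ : ∀ {n} b (V : Subset n) → ∣ b ∷ V ∣ ≡ bit b + ∣ V ∣
∣∷∣ true  V = refl
∣∷∣ false V = refl

∣∣≡countFrom : ∀ {n} (V : Subset n) (f : ℕ → Bool) c →
               (∀ i → f (c + toℕ i) ≡ Vec.lookup V i) → ∣ V ∣ ≡ countFrom f c n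
∣∣≡countFrom []      f c h = refl
∣∣≡countFrom (b ∷ V) f c h =
  trans (∣∷∣ b V) (cong₂ _+_ (cong bit (sym head)) (∣∣≡countFrom V f (suc c) tail))
  where
  head : f c ≡ b
  head = trans (cong f (sym (+-identityʳ c))) (h Fin.zero)
  tail : ∀ i → f (suc c + toℕ i) ≡ Vec.lookup V i
  tail i = trans (cong f (sym (+-suc c (toℕ i)))) (h (Fin.suc i))

∣∣≡countFrom-∋ᶜ : ∀ {p} (U : Subset (suc p)) → ∣ U ∣ ≡ countFrom (U ∋ᶜ_) 0 (suc p)
∣∣≡countFrom-∋ᶜ U = ∣∣≡countFrom U (U ∋ᶜ_) 0 (∋ᶜ-toℕ U)

-- Floors and remainders

module _ (d : ℕ) .{{_ : NonZero d}} where

  [m%d+n]%d≡[m+n]%d : ∀ m n → (m % d + n) % d ≡ (m + n) % d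
  [m%d+n]%d≡[m+n]%d m n = begin
    (m % d + n) % d           ≡⟨ %-distribˡ-+ (m % d) n d ⟩
    (m % d % d + n % d) % d   ≡⟨ cong (λ x → (x + n % d) % d) (m%n%n≡m%n m d) ⟩
    (m % d + n % d) % d       ≡⟨ sym (%-distribˡ-+ m n d) ⟩
    (m + n) % d               ∎
    where open ≡-Reasoning

  [m+n%d]%d≡[m+n]%d : ∀ m n → (m + n % d) % d ≡ (m + n) % d
  [m+n%d]%d≡[m+n]%d m n = begin
    (m + n % d) % d ≡⟨ cong (_% d) (+-comm m (n % d)) ⟩
    (n % d + m) % d ≡⟨ [m%d+n]%d≡[m+n]%d n m ⟩
    (n + m) % d     ≡⟨ cong (_% d) (+-comm n m) ⟩
    (m + n) % d     ∎
    where open ≡-Reasoning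

  [m%d*n]%d≡[m*n]%d : ∀ m n → (m % d * n) % d ≡ (m * n) % d
  [m%d*n]%d≡[m*n]%d m n = begin
    (m % d * n) % d           ≡⟨ %-distribˡ-* (m % d) n d ⟩
    (m % d % d * (n % d)) % d ≡⟨ cong (λ x → (x * (n % d)) % d) (m%n%n≡m%n m d) ⟩
    (m % d * (n % d)) % d     ≡⟨ sym (%-distribˡ-* m n d) ⟩
    (m * n) % d               ∎
    where open ≡-Reasoning

  [m*n%d]%d≡[m*n]%d : ∀ m n → (m * (n % d)) % d ≡ (m * n) % d
  [m*n%d]%d≡[m*n]%d m n = begin
    (m * (n % d)) % d ≡⟨ cong (_% d) (*-comm m (n % d)) ⟩
    (n % d * m) % d   ≡⟨ [m%d*n]%d≡[m*n]%d n m ⟩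
    (n * m) % d       ≡⟨ cong (_% d) (*-comm n m) ⟩
    (m * n) % d       ∎
    where open ≡-Reasoning

  d≤s<2d⇒s%d≡s∸d : ∀ {s} → d ≤ s → s < d + d → s % d ≡ s ∸ d
  d≤s<2d⇒s%d≡s∸d {s} d≤s s<2d = trans (sym (m≤n⇒[n∸m]%m≡n%m d≤s)) (m<n⇒m%n≡m s∸d<d)
    where
    s∸d<d : s ∸ d < d
    s∸d<d = +-cancelʳ-< d _ _ (subst (_< d + d) (sym (m∸n+n≡m d≤s)) s<2d)

  [r+q*d]/d≡q : ∀ r q → r < d → (r + q * d) / d ≡ q
  [r+q*d]/d≡q r q r<d = begin
    (r + q * d) / d       ≡⟨ +-distrib-/ r (q * d) no-carry ⟩
    r / d + q * d / d     ≡⟨ cong₂ _+_ (m<n⇒m/n≡0 r<d) (m*n/n≡m q d) ⟩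
    q                     ∎
    where
    open ≡-Reasoning
    no-carry : r % d + (q * d) % d < d
    no-carry = subst (_< d) (sym (cong₂ _+_ (m<n⇒m%n≡m r<d) (m*n%n≡0 q d)))
                 (subst (_< d) (sym (+-identityʳ r)) r<d)

  [s+q*d]/d≡q+[d≤s] : ∀ s q → s < d + d → (s + q * d) / d ≡ q + bit (d ≤ᵇ s)
  [s+q*d]/d≡q+[d≤s] s q s<2d with d ≤? s
  ... | no s≱d = begin
        (s + q * d) / d        ≡⟨ [r+q*d]/d≡q s q (≰⇒> s≱d) ⟩
        q                      ≡⟨ sym (+-identityʳ q) ⟩
        q + bit false          ≡⟨ cong (λ b → q + bit b) (sym (≤ᵇ-false (≰⇒> s≱d))) ⟩
        q + bit (d ≤ᵇ s)       ∎
    where open ≡-Reasoning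
  ... | yes d≤s = begin
        (s + q * d) / d             ≡⟨ cong (λ x → (x + q * d) / d) (sym (m∸n+n≡m d≤s)) ⟩
        (s ∸ d + d + q * d) / d     ≡⟨ cong (_/ d) (+-assoc (s ∸ d) d (q * d)) ⟩
        (s ∸ d + suc q * d) / d     ≡⟨ [r+q*d]/d≡q (s ∸ d) (suc q) s∸d<d ⟩
        suc q                       ≡⟨ +-comm 1 q ⟩
        q + bit true                ≡⟨ cong (λ b → q + bit b) (sym (≤ᵇ-true d≤s)) ⟩
        q + bit (d ≤ᵇ s)            ∎
    where
    open ≡-Reasoning
    s∸d<d : s ∸ d < d
    s∸d<d = +-cancelʳ-< d _ _ (subst (_< d + d) (sym (m∸n+n≡m d≤s)) s<2d)

  [m+k]/d≡m/d+carry : ∀ m k → k ≤ d → (m + k) / d ≡ m / d + bit (d ≤ᵇ m % d + k)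
  [m+k]/d≡m/d+carry m k k≤d = begin
    (m + k) / d                     ≡⟨ cong (λ x → (x + k) / d) (m≡m%n+[m/n]*n m d) ⟩
    (m % d + m / d * d + k) / d     ≡⟨ cong (_/ d) (swap (m % d) (m / d * d) k) ⟩
    (m % d + k + m / d * d) / d     ≡⟨ [s+q*d]/d≡q+[d≤s] (m % d + k) (m / d) (+-mono-<-≤ (m%n<n m d) k≤d) ⟩
    m / d + bit (d ≤ᵇ m % d + k)    ∎
    where
    open ≡-Reasoning
    swap : ∀ a b c → a + b + c ≡ a + c + b
    swap = solve-∀

  [m+n]/d≡m/d+n/d+carry : ∀ m n → ∃ λ b → (m + n) / d ≡ m / d + n / d + bit b
  [m+n]/d≡m/d+n/d+carry m n = (d ≤ᵇ m % d + n % d) , (begin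
    (m + n) / d
      ≡⟨ cong₂ (λ x y → (x + y) / d) (m≡m%n+[m/n]*n m d) (m≡m%n+[m/n]*n n d) ⟩
    (m % d + m / d * d + (n % d + n / d * d)) / d
      ≡⟨ cong (_/ d) (regroup (m % d) (m / d) (n % d) (n / d) d) ⟩
    (m % d + n % d + (m / d + n / d) * d) / d
      ≡⟨ [s+q*d]/d≡q+[d≤s] (m % d + n % d) (m / d + n / d) (+-mono-< (m%n<n m d) (m%n<n n d)) ⟩
    m / d + n / d + bit (d ≤ᵇ m % d + n % d) ∎)
    where
    open ≡-Reasoning
    regroup : ∀ r q r' q' d → r + q * d + (r' + q' * d) ≡ r + r' + (q + q') * d
    regroup = solve-∀

module Window (p k : ℕ) (2k≤N : k + k ≤ suc p) where
  private
    N : ℕ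
    N = suc p

  window : ℕ → ℕ → Bool
  window d y = N ≤ᵇ (y + d) % N + k

  k≤N : k ≤ N
  k≤N = ≤-trans (m≤m+n k k) 2k≤N

  k≤N∸k : k ≤ N ∸ k
  k≤N∸k = subst (_≤ N ∸ k) (m+n∸n≡m k k) (∸-monoˡ-≤ k 2k≤N)

  N∸k+k≡N : N ∸ k + k ≡ N
  N∸k+k≡N = m∸n+n≡m k≤N

  window-0 : ∀ {y} → y < N → window 0 y ≡ (N ≤ᵇ y + k)
  window-0 {y} y<N = cong (λ x → N ≤ᵇ x + k) (trans (cong (_% N) (+-identityʳ y)) (m<n⇒m%n≡m y<N))

  window-disjoint : ∀ {d y} → k ≤ d → d ≤ N ∸ k → y < N → window 0 y ≡ true → window d y ≡ false
  window-disjoint {d} {y} k≤d d≤N∸k y<N in₀ = ≤ᵇ-false (begin-strict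
      (y + d) % N + k   ≡⟨ cong (_+ k) (d≤s<2d⇒s%d≡s∸d N N≤y+d (+-mono-<-≤ y<N d≤N)) ⟩
      y + d ∸ N + k     <⟨ +-cancelʳ-< N _ _ (begin-strict
                             y + d ∸ N + k + N ≡⟨ cancel ⟩
                             y + (d + k)       <⟨ +-mono-<-≤ y<N d+k≤N ⟩
                             N + N             ∎) ⟩
      N                 ∎)
    where
    open ≤-Reasoning
    d+k≤N : d + k ≤ N
    d+k≤N = subst (d + k ≤_) N∸k+k≡N (+-monoˡ-≤ k d≤N∸k)
    d≤N : d ≤ N
    d≤N = ≤-trans (m≤m+n d k) d+k≤N
    N≤y+d : N ≤ y + d
    N≤y+d = ≤-trans (≤ᵇ-true⁻ (trans (sym (window-0 y<N)) in₀)) (+-monoʳ-≤ y k≤d)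
    cancel : y + d ∸ N + k + N ≡ y + (d + k)
    cancel = begin-equality
      y + d ∸ N + k + N   ≡⟨ +-assoc (y + d ∸ N) k N ⟩
      y + d ∸ N + (k + N) ≡⟨ cong (y + d ∸ N +_) (+-comm k N) ⟩
      y + d ∸ N + (N + k) ≡⟨ sym (+-assoc (y + d ∸ N) N k) ⟩
      y + d ∸ N + N + k   ≡⟨ cong (_+ k) (m∸n+n≡m N≤y+d) ⟩
      y + d + k           ≡⟨ +-assoc y d k ⟩
      y + (d + k)         ∎

  module _ (0<k : 0 < k) where

    N∸k<N : N ∸ k < N
    N∸k<N = ∸-monoʳ-< 0<k k≤N

    N≤p+k : N ≤ p + k
    N≤p+k = subst (_≤ p + k) (+-comm p 1) (+-monoʳ-≤ p 0<k)

    window-meet-low : ∀ {d} → d < k → window 0 (N ∸ k) ≡ true × window d (N ∸ k) ≡ true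
    window-meet-low {d} d<k =
        trans (window-0 N∸k<N) (≤ᵇ-true (≤-reflexive (sym N∸k+k≡N)))
      , trans (cong (λ x → N ≤ᵇ x + k) (m<n⇒m%n≡m N∸k+d<N))
              (≤ᵇ-true (≤-trans (≤-reflexive (sym N∸k+k≡N)) (+-monoˡ-≤ k (m≤m+n (N ∸ k) d))))
      where
      N∸k+d<N : N ∸ k + d < N
      N∸k+d<N = subst (N ∸ k + d <_) N∸k+k≡N (+-monoʳ-< (N ∸ k) d<k)

    window-meet-high : ∀ {d} → N ∸ k < d → d < N → window 0 p ≡ true × window d p ≡ true
    window-meet-high {suc d′} N∸k≤d′ d<N =
        trans (window-0 ≤-refl) (≤ᵇ-true N≤p+k)
      , trans (cong (λ x → N ≤ᵇ x + k) wrap)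
              (≤ᵇ-true (subst (_≤ d′ + k) N∸k+k≡N (+-monoˡ-≤ k (s≤s⁻¹ N∸k≤d′))))
      where
      wrap : (p + suc d′) % N ≡ d′
      wrap = begin
        (p + suc d′) % N ≡⟨ cong (_% N) (trans (+-suc p d′) (+-comm N d′)) ⟩
        (d′ + N) % N     ≡⟨ [m+n]%n≡m%n d′ N ⟩
        d′ % N           ≡⟨ m<n⇒m%n≡m (<-trans ≤-refl d<N) ⟩
        d′               ∎
        where open ≡-Reasoning

    window-separates : ∀ {d d′} → d < d′ → d′ ≤ N ∸ k → window d (p ∸ d) ≡ true × window d′ (p ∸ d) ≡ false
    window-separates {d} {d′} d<d′ d′≤N∸k =
        trans (cong (λ x → N ≤ᵇ x % N + k) (m∸n+n≡m d≤p))
              (trans (cong (λ x → N ≤ᵇ x + k) (m<n⇒m%n≡m (n<1+n p))) (≤ᵇ-true N≤p+k))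
      , trans (cong (λ x → N ≤ᵇ x + k) wrap) (≤ᵇ-false (subst (δ + k <_) N∸k+k≡N (+-monoˡ-< k δ<N∸k)))
      where
      δ : ℕ
      δ = d′ ∸ suc d
      d′≡ : d′ ≡ suc (d + δ)
      d′≡ = sym (m+[n∸m]≡n d<d′)
      d≤p : d ≤ p
      d≤p = s≤s⁻¹ (≤-trans (≤-trans d<d′ d′≤N∸k) (<⇒≤ N∸k<N))
      δ<N∸k : δ < N ∸ k
      δ<N∸k = <-≤-trans (subst (δ <_) (sym d′≡) (s≤s (m≤n+m δ d))) d′≤N∸k
      wrap : (p ∸ d + d′) % N ≡ δ
      wrap = begin
        (p ∸ d + d′) % N          ≡⟨ cong (λ x → (p ∸ d + x) % N) d′≡ ⟩
        (p ∸ d + suc (d + δ)) % N ≡⟨ cong (_% N) (+-suc (p ∸ d) (d + δ)) ⟩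
        suc (p ∸ d + (d + δ)) % N ≡⟨ cong (λ x → suc x % N) (sym (+-assoc (p ∸ d) d δ)) ⟩
        suc (p ∸ d + d + δ) % N   ≡⟨ cong (λ x → suc (x + δ) % N) (m∸n+n≡m d≤p) ⟩
        (N + δ) % N               ≡⟨ cong (_% N) (+-comm N δ) ⟩
        (δ + N) % N               ≡⟨ [m+n]%n≡m%n δ N ⟩
        δ % N                     ≡⟨ m<n⇒m%n≡m (<-trans δ<N∸k N∸k<N) ⟩
        δ                         ∎
        where open ≡-Reasoning

-- W t is the set of positions i at which ⌊(i k + t)/N⌋ increases.
module Christoffel (p k : ℕ) where

  N : ℕ
  N = suc p

  inW : ℕ → ℕ → Bool
  inW t i = N ≤ᵇ (i * k + t) % N + k

  W : ℕ → Subset N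
  W t = tabulate (inW t ∘ toℕ)

  inW-% : ∀ t i → inW t (i % N) ≡ inW t i
  inW-% t i = cong (λ x → N ≤ᵇ x + k) (begin
    (i % N * k + t) % N       ≡⟨ sym ([m%d+n]%d≡[m+n]%d N (i % N * k) t) ⟩
    ((i % N * k) % N + t) % N ≡⟨ cong (λ x → (x + t) % N) ([m%d*n]%d≡[m*n]%d N i k) ⟩
    ((i * k) % N + t) % N     ≡⟨ [m%d+n]%d≡[m+n]%d N (i * k) t ⟩
    (i * k + t) % N           ∎)
    where open ≡-Reasoning

  W∋ᶜ : ∀ t i → W t ∋ᶜ i ≡ inW t i
  W∋ᶜ t i = trans (lookup∘tabulate (inW t ∘ toℕ) (fromℕ< (m%n<n i N)))
                  (trans (cong (inW t) (toℕ-fromℕ< (m%n<n i N))) (inW-% t i))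

  arcCount-W : ∀ t j m → arcCount (W t) j m ≡ countFrom (inW t) j m
  arcCount-W t j m = trans (arcCount≡countFrom (W t) j m) (sumFrom-cong (cong bit ∘ W∋ᶜ t) j m)

  module _ (k≤N : k ≤ N) where

    ⌊⌋+countFrom-inW : ∀ t j m → (j * k + t) / N + countFrom (inW t) j m ≡ ((j + m) * k + t) / N
    ⌊⌋+countFrom-inW t j zero    = trans (+-identityʳ _) (cong (λ x → (x * k + t) / N) (sym (+-identityʳ j)))
    ⌊⌋+countFrom-inW t j (suc m) = begin
        (j * k + t) / N + (bit (inW t j) + countFrom (inW t) (suc j) m)
      ≡⟨ sym (+-assoc ((j * k + t) / N) _ _) ⟩
        (j * k + t) / N + bit (inW t j) + countFrom (inW t) (suc j) m
      ≡⟨ cong (_+ countFrom (inW t) (suc j) m) (sym ([m+k]/d≡m/d+carry N (j * k + t) k k≤N)) ⟩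
        (j * k + t + k) / N + countFrom (inW t) (suc j) m
      ≡⟨ cong (λ x → x / N + countFrom (inW t) (suc j) m) (step j k t) ⟩
        (suc j * k + t) / N + countFrom (inW t) (suc j) m
      ≡⟨ ⌊⌋+countFrom-inW t (suc j) m ⟩
        ((suc j + m) * k + t) / N
      ≡⟨ cong (λ x → (x * k + t) / N) (sym (+-suc j m)) ⟩
        ((j + suc m) * k + t) / N ∎
      where
      open ≡-Reasoning
      step : ∀ j k t → j * k + t + k ≡ suc j * k + t
      step = solve-∀

    countFrom-inW : ∀ t j m → ∃ λ b → countFrom (inW t) j m ≡ m * k / N + bit b
    countFrom-inW t j m with [m+n]/d≡m/d+n/d+carry N (j * k + t) (m * k)
    ... | b , split = b , +-cancelˡ-≡ ((j * k + t) / N) _ _ (begin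
        (j * k + t) / N + countFrom (inW t) j m    ≡⟨ ⌊⌋+countFrom-inW t j m ⟩
        ((j + m) * k + t) / N                      ≡⟨ cong (_/ N) (regroup j m k t) ⟩
        (j * k + t + m * k) / N                    ≡⟨ split ⟩
        (j * k + t) / N + m * k / N + bit b        ≡⟨ +-assoc ((j * k + t) / N) _ _ ⟩
        (j * k + t) / N + (m * k / N + bit b)      ∎)
      where
      open ≡-Reasoning
      regroup : ∀ j m k t → (j + m) * k + t ≡ j * k + t + m * k
      regroup = solve-∀

    W-wellSpread : ∀ t → wellSpreadᵇ (W t) ≡ true
    W-wellSpread t =
      allᵇ⁺ (map suc (upTo p)) _ λ {m} _ → allᵇ⁺ (upTo N) _ λ {i} _ →
      allᵇ⁺ (upTo N) (λ j → ∣ arcCount (W t) i m - arcCount (W t) j m ∣ ≤ᵇ 1) λ {j} _ →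
      ≤ᵇ-true (balanced m i j)
      where
      balanced : ∀ m i j → ∣ arcCount (W t) i m - arcCount (W t) j m ∣ ≤ 1
      balanced m i j with countFrom-inW t i m | countFrom-inW t j m
      ... | b , eb | b' , eb'
        rewrite arcCount-W t i m | arcCount-W t j m | eb | eb' | ∣m+n-m+o∣≡∣n-o∣ (m * k / N) (bit b) (bit b')
        = ∣bit-bit∣≤1 b b'

    W-size : ∀ t → t < N → ∣ W t ∣ ≡ k
    W-size t t<N = begin
      ∣ W t ∣                                  ≡⟨ ∣∣≡countFrom-∋ᶜ (W t) ⟩
      countFrom (W t ∋ᶜ_) 0 N                  ≡⟨ sumFrom-cong (cong bit ∘ W∋ᶜ t) 0 N ⟩
      countFrom (inW t) 0 N                    ≡⟨ cong (_+ countFrom (inW t) 0 N) (sym (m<n⇒m/n≡0 t<N)) ⟩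
      (0 * k + t) / N + countFrom (inW t) 0 N  ≡⟨ ⌊⌋+countFrom-inW t 0 N ⟩
      (N * k + t) / N                          ≡⟨ cong (_/ N) (trans (+-comm (N * k) t) (cong (t +_) (*-comm N k))) ⟩
      (t + k * N) / N                          ≡⟨ [r+q*d]/d≡q N t k t<N ⟩
      k                                        ∎
      where open ≡-Reasoning

  module _ (2k≤N : k + k ≤ N) where
    open Window p k 2k≤N using (window-0; window-disjoint; k≤N; k≤N∸k)

    inW⇒¬inW-suc : ∀ t i → inW t i ≡ true → inW t (i + 1) ≡ false
    inW⇒¬inW-suc t i h = trans (cong (λ x → N ≤ᵇ x + k) wrap)
      (window-disjoint ≤-refl k≤N∸k y<N (trans (window-0 y<N) h))
      where
      y : ℕ
      y = (i * k + t) % N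
      y<N : y < N
      y<N = m%n<n (i * k + t) N
      wrap : ((i + 1) * k + t) % N ≡ (y + k) % N
      wrap = begin
        ((i + 1) * k + t) % N ≡⟨ cong (_% N) (step i k t) ⟩
        (i * k + t + k) % N   ≡⟨ sym ([m%d+n]%d≡[m+n]%d N (i * k + t) k) ⟩
        (y + k) % N           ∎
        where
        open ≡-Reasoning
        step : ∀ i k t → (i + 1) * k + t ≡ i * k + t + k
        step = solve-∀

    W-stable : ∀ t → stableᵇ (W t) ≡ true
    W-stable t = allᵇ⁺ (upTo N) (λ i → not ((W t ∋ᶜ i) ∧ (W t ∋ᶜ (i + 1)))) λ {i} _ → separated i
      where
      separated : ∀ i → not ((W t ∋ᶜ i) ∧ (W t ∋ᶜ (i + 1))) ≡ true
      separated i rewrite W∋ᶜ t i | W∋ᶜ t (i + 1) with inW t i in eq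
      ... | false = refl
      ... | true  rewrite inW⇒¬inW-suc t i eq = refl

    W-isQVertex : ∀ t → t < N → isQVertexᵇ N k (W t) ≡ true
    W-isQVertex t t<N =
      ∧-intro (T⇒≡true (≡⇒≡ᵇ _ _ (W-size k≤N t t<N))) (∧-intro (W-stable t) (W-wellSpread k≤N t))

-- Well-spread sets are rotations of one set

m∸n≤o⇒m≤n+o : ∀ {m n o} → m ∸ n ≤ o → m ≤ n + o
m∸n≤o⇒m≤n+o {m} {n} h = ≤-trans (m≤n+m∸n m n) (+-monoʳ-≤ n h)

max-attained : ∀ (f : ℕ → ℕ) n → ∃ λ i₀ → i₀ ≤ n × (∀ i → i ≤ n → f i ≤ f i₀)
max-attained f zero = 0 , z≤n , λ { .0 z≤n → ≤-refl }
max-attained f (suc n) with max-attained f n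
... | i₀ , i₀≤n , max with f (suc n) ≤? f i₀
...   | yes below = i₀ , m≤n⇒m≤1+n i₀≤n , λ i i≤1+n → case (m≤n⇒m<n∨m≡n i≤1+n)
  where
  case : ∀ {i} → i < suc n ⊎ i ≡ suc n → f i ≤ f i₀
  case (inj₁ i<1+n) = max _ (s≤s⁻¹ i<1+n)
  case (inj₂ refl)  = below
...   | no above = suc n , ≤-refl , λ i i≤1+n → case (m≤n⇒m<n∨m≡n i≤1+n)
  where
  case : ∀ {i} → i < suc n ⊎ i ≡ suc n → f i ≤ f (suc n)
  case (inj₁ i<1+n) = ≤-trans (max _ (s≤s⁻¹ i<1+n)) (<⇒≤ (≰⇒> above))
  case (inj₂ refl)  = ≤-refl

module Characterisation (p k : ℕ) (k≤N : k ≤ suc p) (coprime : Coprime (suc p) k)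
                        (U : Subset (suc p)) (size : ∣ U ∣ ≡ k) (spread : wellSpreadᵇ U ≡ true) where
  open Christoffel p k using (N; inW; W)

  u : ℕ → Bool
  u i = U ∋ᶜ i

  φ : ℕ → ℕ
  φ = countFrom u 0

  φ-+ : ∀ i m → φ (i + m) ≡ φ i + countFrom u i m
  φ-+ = sumFrom-+ (bit ∘ u) 0

  φN≡k : φ N ≡ k
  φN≡k = trans (sym (∣∣≡countFrom-∋ᶜ U)) size

  arc-balanced : ∀ m i j → 0 < m → m ≤ p → i < N → j < N → countFrom u i m ≤ countFrom u j m + 1
  arc-balanced m@(suc _) i j _ m≤p i<N j<N =
    ≤-trans (m≤∣m-n∣+n a b) (subst (∣ a - b ∣ + b ≤_) (+-comm 1 b) (+-monoˡ-≤ b ∣a-b∣≤1))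
    where
    a : ℕ
    a = countFrom u i m
    b : ℕ
    b = countFrom u j m
    ∣a-b∣≤1 : ∣ a - b ∣ ≤ 1
    ∣a-b∣≤1 = subst (_≤ 1) (cong₂ ∣_-_∣ (arcCount≡countFrom U i m) (arcCount≡countFrom U j m))
      (≤ᵇ-true⁻ (allᵇ⁻ (upTo N) _ (allᵇ⁻ (upTo N) _ (allᵇ⁻ (map suc (upTo p)) _ spread
        (∈-map⁺ suc (∈-upTo⁺ m≤p))) (∈-upTo⁺ i<N)) (∈-upTo⁺ j<N)))

  N∤m*k : ∀ m → 0 < m → m < N → ¬ (N ∣ m * k)
  N∤m*k m 0<m m<N N∣mk =
    <⇒≱ m<N (∣⇒≤ ⦃ >-nonZero 0<m ⦄ (coprime-divisor coprime (subst (N ∣_) (*-comm m k) N∣mk)))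

  sum-arcs : ∀ m → sumFrom (λ i → countFrom u i m) 0 N ≡ m * k
  sum-arcs m = trans (sumFrom-countFrom u N (∋ᶜ-periodic U) m) (cong (m *_) φN≡k)

  -- The N arcs of length m hold m k points in total and pairwise differ by at most one point,
  -- so each holds ⌊m k / N⌋ or ⌈m k / N⌉; as N ∤ m k, the bounds below are strict.
  proper-arc-bounds : ∀ m i → 0 < m → m ≤ p → i < N →
                      m * k < N * countFrom u i m + N × N * countFrom u i m < m * k + N
  proper-arc-bounds m i 0<m m≤p i<N = lower , upper
    where
    c : ℕ
    c = countFrom u i m
    N∤ : ¬ (N ∣ m * k)
    N∤ = N∤m*k m 0<m (s≤s m≤p)
    lower : m * k < N * c + N
    lower = ≤∧≢⇒< (subst₂ _≤_ (sum-arcs m) (trans (*-distribˡ-+ N c 1) (cong (N * c +_) (*-identityʳ N)))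
                    (sumFrom-≤ (λ j → countFrom u j m) (c + 1) 0 N (λ j j<N → arc-balanced m j i 0<m m≤p j<N i<N)))
      (λ eq → N∤ (divides (c + 1) (begin
        m * k         ≡⟨ eq ⟩
        N * c + N     ≡⟨ cong (N * c +_) (sym (*-identityʳ N)) ⟩
        N * c + N * 1 ≡⟨ sym (*-distribˡ-+ N c 1) ⟩
        N * (c + 1)   ≡⟨ *-comm N (c + 1) ⟩
        (c + 1) * N   ∎)))
      where open ≡-Reasoning
    upper : N * c < m * k + N
    upper = ≤∧≢⇒< (subst (λ x → N * c ≤ x + N) (sum-arcs m)
                    (sumFrom-≥ (λ j → countFrom u j m) c 0 N (λ j j<N → arc-balanced m i j 0<m m≤p i<N j<N)))
      (λ eq → N∤ (divides (c ∸ 1) (sym (begin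
        (c ∸ 1) * N     ≡⟨ *-distribʳ-∸ N c 1 ⟩
        c * N ∸ 1 * N   ≡⟨ cong₂ _∸_ (*-comm c N) (+-identityʳ N) ⟩
        N * c ∸ N       ≡⟨ cong (_∸ N) eq ⟩
        m * k + N ∸ N   ≡⟨ m+n∸n≡m (m * k) N ⟩
        m * k           ∎))))
      where open ≡-Reasoning

  arc-bounds : ∀ m i → 0 < m → m ≤ N → i < N →
               m * k < N * countFrom u i m + N × N * countFrom u i m < m * k + N
  arc-bounds m i 0<m m≤N i<N with m ≟ N
  ... | no m≢N   = proper-arc-bounds m i 0<m (s≤s⁻¹ (≤∧≢⇒< m≤N m≢N)) i<N
  ... | yes refl = subst (λ c → N * k < N * c + N × N * c < N * k + N) (sym full-arc)
                      (m<m+n (N * k) z<s , m<m+n (N * k) z<s)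
    where
    full-arc : countFrom u i N ≡ k
    full-arc = trans (sumFrom-periodic (bit ∘ u) N (cong bit ∘ ∋ᶜ-periodic U) i) φN≡k

  φ-spread-+ : ∀ i m → i + m ≤ N →
               N * φ (i + m) + i * k < N * φ i + (i + m) * k + N × N * φ i + (i + m) * k < N * φ (i + m) + i * k + N
  φ-spread-+ i zero _ rewrite +-identityʳ i = m<m+n (N * φ i + i * k) z<s , m<m+n (N * φ i + i * k) z<s
  φ-spread-+ i m@(suc _) i+m≤N rewrite φ-+ i m =
      subst₂ _<_ (sym (shift₁ N (φ i) c i k)) (sym (shift₂ N (φ i) i m k))
                 (+-monoʳ-< (N * φ i + i * k) (proj₂ bounds))
    , subst₂ _<_ (sym (shift₂′ N (φ i) i m k)) (sym (shift₁′ N (φ i) c i k))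
                 (+-monoʳ-< (N * φ i + i * k) (proj₁ bounds))
    where
    c : ℕ
    c = countFrom u i m
    bounds : m * k < N * c + N × N * c < m * k + N
    bounds = arc-bounds m i z<s (≤-trans (m≤n+m m i) i+m≤N) (≤-trans (m<m+n i z<s) i+m≤N)
    shift₁ : ∀ N a c i k → N * (a + c) + i * k ≡ N * a + i * k + N * c
    shift₁ = solve-∀
    shift₂ : ∀ N a i m k → N * a + (i + m) * k + N ≡ N * a + i * k + (m * k + N)
    shift₂ = solve-∀
    shift₁′ : ∀ N a c i k → N * (a + c) + i * k + N ≡ N * a + i * k + (N * c + N)
    shift₁′ = solve-∀
    shift₂′ : ∀ N a i m k → N * a + (i + m) * k ≡ N * a + i * k + m * k
    shift₂′ = solve-∀

  φ-spread : ∀ a b → a ≤ N → b ≤ N → N * φ b + a * k < N * φ a + b * k + N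
  φ-spread a b a≤N b≤N with ≤-total a b
  ... | inj₁ a≤b = subst (λ b → N * φ b + a * k < N * φ a + b * k + N) (m+[n∸m]≡n a≤b)
                     (proj₁ (φ-spread-+ a (b ∸ a) (subst (_≤ N) (sym (m+[n∸m]≡n a≤b)) b≤N)))
  ... | inj₂ b≤a = subst (λ a → N * φ b + a * k < N * φ a + b * k + N) (m+[n∸m]≡n b≤a)
                     (proj₂ (φ-spread-+ b (a ∸ b) (subst (_≤ N) (sym (m+[n∸m]≡n b≤a)) a≤N)))

  -- ∸ truncates, but N φ(0) − 0 k = 0, so a zero maximum is attained at i = 0.
  φ-peak : ∃ λ i₁ → ∃ λ M → i₁ ≤ N × N * φ i₁ ≡ i₁ * k + M × (∀ i → i ≤ N → N * φ i ≤ i * k + M)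
  φ-peak with max-attained (λ i → N * φ i ∸ i * k) N
  ... | i₀ , i₀≤N , max with N * φ i₀ ∸ i₀ * k ≟ 0
  ...   | yes ≡0 = 0 , 0 , z≤n , *-zeroʳ N ,
                   λ i i≤N → m∸n≤o⇒m≤n+o (subst (N * φ i ∸ i * k ≤_) ≡0 (max i i≤N))
  ...   | no  ≢0 = i₀ , N * φ i₀ ∸ i₀ * k , i₀≤N , sym (m+[n∸m]≡n {i₀ * k} (<⇒≤ (m∸n≢0⇒n<m ≢0))) ,
                   λ i i≤N → m∸n≤o⇒m≤n+o (max i i≤N)

  -- With M the maximum of N φ(i) − i k, φ-spread squeezes N φ(i) − i k into (M − N, M].
  module Peak (i₁ M : ℕ) (i₁≤N : i₁ ≤ N) (attained : N * φ i₁ ≡ i₁ * k + M)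
              (bounded : ∀ i → i ≤ N → N * φ i ≤ i * k + M) where

    above : ∀ i → i ≤ N → i * k + M < N * φ i + N
    above i i≤N = +-cancelˡ-< (i₁ * k) _ _ (subst₂ _<_ (swap₁ (i₁ * k) M (i * k)) (swap₂ (N * φ i) (i₁ * k) N)
                    (subst (λ x → x + i * k < N * φ i + i₁ * k + N) attained (φ-spread i i₁ i≤N i₁≤N)))
      where
      swap₁ : ∀ a b c → a + b + c ≡ a + (c + b)
      swap₁ = solve-∀
      swap₂ : ∀ a b c → a + b + c ≡ b + (a + c)
      swap₂ = solve-∀

    φ≡⌊⌋ : ∀ i → i ≤ N → φ i ≡ (i * k + M) / N
    φ≡⌊⌋ i i≤N = sym (trans (cong (_/ N) (sym r+φ*N)) ([r+q*d]/d≡q N r (φ i) r<N))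
      where
      r : ℕ
      r = i * k + M ∸ N * φ i
      r+φ*N : r + φ i * N ≡ i * k + M
      r+φ*N = trans (cong (r +_) (*-comm (φ i) N)) (m∸n+n≡m (bounded i i≤N))
      r<N : r < N
      r<N = +-cancelʳ-< (N * φ i) r N
              (subst₂ _<_ (sym (m∸n+n≡m (bounded i i≤N))) (+-comm (N * φ i) N) (above i i≤N))

    M<N : M < N
    M<N = subst (M <_) (cong (_+ N) (*-zeroʳ N)) (above 0 z≤n)

    u≡inW : ∀ i → i < N → u i ≡ inW M i
    u≡inW i i<N = bit-injective (+-cancelˡ-≡ (φ i) _ _ (begin
      φ i + bit (u i)                  ≡⟨ cong (φ i +_) (sym (+-identityʳ _)) ⟩
      φ i + countFrom u i 1            ≡⟨ sym (φ-+ i 1) ⟩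
      φ (i + 1)                        ≡⟨ φ≡⌊⌋ (i + 1) (subst (_≤ N) (+-comm 1 i) i<N) ⟩
      ((i + 1) * k + M) / N            ≡⟨ cong (_/ N) (step i k M) ⟩
      (i * k + M + k) / N              ≡⟨ [m+k]/d≡m/d+carry N (i * k + M) k k≤N ⟩
      (i * k + M) / N + bit (inW M i)  ≡⟨ cong (_+ bit (inW M i)) (sym (φ≡⌊⌋ i (<⇒≤ i<N))) ⟩
      φ i + bit (inW M i)              ∎))
      where
      open ≡-Reasoning
      step : ∀ i k M → (i + 1) * k + M ≡ i * k + M + k
      step = solve-∀

    U≡W : U ≡ W M
    U≡W = trans (sym (tabulate∘lookup U))
                (tabulate-cong (λ f → trans (sym (∋ᶜ-toℕ U f)) (u≡inW (toℕ f) (toℕ<n f))))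

  U≡W : ∃ λ M → M < N × U ≡ W M
  U≡W with φ-peak
  ... | i₁ , M , i₁≤N , attained , bounded = M , P.M<N , P.U≡W
    where module P = Peak i₁ M i₁≤N attained bounded

isQVertex⇒≡W : ∀ p k → k ≤ suc p → Coprime (suc p) k → (U : Subset (suc p)) → isQVertexᵇ (suc p) k U ≡ true →
               ∃ λ M → M < suc p × U ≡ Christoffel.W p k M
isQVertex⇒≡W p k k≤N coprime U vertex =
  Characterisation.U≡W p k k≤N coprime U (≡ᵇ⇒≡ ∣ U ∣ k (≡true⇒T hasSize)) spread
  where
  hasSize : hasSizeᵇ k U ≡ true
  hasSize = ∧-conicalˡ (hasSizeᵇ k U) _ vertex
  spread : wellSpreadᵇ U ≡ true
  spread = ∧-conicalʳ (stableᵇ U) _ (∧-conicalʳ (hasSizeᵇ k U) _ vertex)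

-- Neighbours of a rotation

Unique∧⊆⇒length≤ : ∀ {A : Set} (xs ys : List A) → Unique xs → xs ⊆ ys → length xs ≤ length ys
Unique∧⊆⇒length≤ []       ys _           _  = z≤n
Unique∧⊆⇒length≤ (x ∷ xs) ys (x∉xs ∷ uxs) xs⊆ys with ∈-∃++ (xs⊆ys (here refl))
... | ys₁ , ys₂ , refl = begin
    suc (length xs)                ≤⟨ s≤s (Unique∧⊆⇒length≤ xs (ys₁ ++ ys₂) uxs xs⊆ys₁++ys₂) ⟩
    suc (length (ys₁ ++ ys₂))      ≡⟨ cong suc (length-++ ys₁) ⟩
    suc (length ys₁ + length ys₂)  ≡⟨ sym (+-suc (length ys₁) (length ys₂)) ⟩
    length ys₁ + suc (length ys₂)  ≡⟨ sym (length-++ ys₁) ⟩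
    length (ys₁ ++ x ∷ ys₂)        ∎
  where
  open ≤-Reasoning
  xs⊆ys₁++ys₂ : xs ⊆ ys₁ ++ ys₂
  xs⊆ys₁++ys₂ z∈xs with ∈-++⁻ ys₁ (xs⊆ys (there z∈xs))
  ... | inj₁ z∈ys₁         = ∈-++⁺ˡ z∈ys₁
  ... | inj₂ (here refl)   = ⊥-elim (All.lookup x∉xs z∈xs refl)
  ... | inj₂ (there z∈ys₂) = ∈-++⁺ʳ ys₁ z∈ys₂

Unique∧⊆∧⊇⇒length≡ : ∀ {A : Set} (xs ys : List A) → Unique xs → Unique ys →
                     xs ⊆ ys → ys ⊆ xs → length xs ≡ length ys
Unique∧⊆∧⊇⇒length≡ xs ys uxs uys xs⊆ys ys⊆xs =
  ≤-antisym (Unique∧⊆⇒length≤ xs ys uxs xs⊆ys) (Unique∧⊆⇒length≤ ys xs uys ys⊆xs)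

∈-allSubsets : ∀ {n} (V : Subset n) → V ∈ allSubsets n
∈-allSubsets []                = here refl
∈-allSubsets (true ∷ V)        = ∈-++⁺ˡ (∈-map⁺ (true ∷_) (∈-allSubsets V))
∈-allSubsets {suc n} (false ∷ V) = ∈-++⁺ʳ (map (true ∷_) (allSubsets n)) (∈-map⁺ (false ∷_) (∈-allSubsets V))

allSubsets-unique : ∀ n → Unique (allSubsets n)
allSubsets-unique zero    = All.[] ∷ []
allSubsets-unique (suc n) = Unique.++⁺ (Unique.map⁺ ∷-injectiveʳ (allSubsets-unique n))
                                       (Unique.map⁺ ∷-injectiveʳ (allSubsets-unique n)) heads-differ
  where
  heads-differ : ∀ {V} → ¬ (V ∈ map (true ∷_) (allSubsets n) × V ∈ map (false ∷_) (allSubsets n))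
  heads-differ (V∈₁ , V∈₂) with ∈-map⁻ (true ∷_) V∈₁ | ∈-map⁻ (false ∷_) V∈₂
  ... | _ , _ , refl | _ , _ , ()

disjointᵇ⁻ : ∀ {n} (U V : Subset n) → disjointᵇ U V ≡ true → ∀ i → i < n → not (U ∋ᶜ i ∧ V ∋ᶜ i) ≡ true
disjointᵇ⁻ {n} U V h i i<n = allᵇ⁻ (upTo n) (λ i → not (U ∋ᶜ i ∧ V ∋ᶜ i)) h (∈-upTo⁺ i<n)

disjointᵇ⁺ : ∀ {n} (U V : Subset n) → (∀ i → not (U ∋ᶜ i ∧ V ∋ᶜ i) ≡ true) → disjointᵇ U V ≡ true
disjointᵇ⁺ {n} U V h = allᵇ⁺ (upTo n) (λ i → not (U ∋ᶜ i ∧ V ∋ᶜ i)) (λ _ → h _)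

module Neighbourhood (p k : ℕ) (0<k : 0 < k) (2k≤N : k + k ≤ suc p) (coprime : Coprime (suc p) k) where
  open Christoffel p k
  open Window p k 2k≤N

  1<N : 1 < N
  1<N = ≤-trans (+-mono-≤ 0<k 0<k) 2k≤N

  k-invertible : ∃ λ a → (a * k) % N ≡ 1
  k-invertible with coprime-Bézout coprime
  ... | Bézout.-+ x y eq = y , (begin
      (y * k) % N      ≡⟨ cong (_% N) (sym eq) ⟩
      (1 + x * N) % N  ≡⟨ [m+kn]%n≡m%n 1 x N ⟩
      1 % N            ≡⟨ m<n⇒m%n≡m 1<N ⟩
      1                ∎)
    where open ≡-Reasoning
  -- Here y k ≡ −1 (mod N), so y (N − 1) = y p inverts k.
  ... | Bézout.+- x y eq = y * p , (begin
      (y * p * k) % N              ≡⟨ sym ([m+n]%n≡m%n (y * p * k) N) ⟩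
      (y * p * k + N) % N          ≡⟨ cong (_% N) (regroup y p k) ⟩
      (1 + p * (1 + y * k)) % N    ≡⟨ cong (λ x → (1 + p * x) % N) eq ⟩
      (1 + p * (x * N)) % N        ≡⟨ cong (λ x → (1 + x) % N) (sym (*-assoc p x N)) ⟩
      (1 + p * x * N) % N          ≡⟨ [m+kn]%n≡m%n 1 (p * x) N ⟩
      1 % N                        ≡⟨ m<n⇒m%n≡m 1<N ⟩
      1                            ∎)
    where
    open ≡-Reasoning
    regroup : ∀ y p k → y * p * k + suc p ≡ 1 + p * (1 + y * k)
    regroup = solve-∀

  pos : ℕ → ℕ → ℕ
  pos M i = (i * k + M) % N

  pos-surjective : ∀ M y → M ≤ N → y < N → ∃ λ i → i < N × pos M i ≡ y
  pos-surjective M y M≤N y<N = i , m%n<n (a * c) N , (begin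
      (i * k + M) % N       ≡⟨ sym ([m%d+n]%d≡[m+n]%d N (i * k) M) ⟩
      ((i * k) % N + M) % N ≡⟨ cong (λ x → (x + M) % N) i*k≡c ⟩
      (c % N + M) % N       ≡⟨ [m%d+n]%d≡[m+n]%d N c M ⟩
      (c + M) % N           ≡⟨ cong (_% N) (trans (+-assoc y (N ∸ M) M) (cong (y +_) (m∸n+n≡m M≤N))) ⟩
      (y + N) % N           ≡⟨ [m+n]%n≡m%n y N ⟩
      y % N                 ≡⟨ m<n⇒m%n≡m y<N ⟩
      y                     ∎)
    where
    open ≡-Reasoning
    a : ℕ
    a = proj₁ k-invertible
    c : ℕ
    c = y + (N ∸ M)
    i : ℕ
    i = (a * c) % N
    i*k≡c : (i * k) % N ≡ c % N
    i*k≡c = begin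
      ((a * c) % N * k) % N   ≡⟨ [m%d*n]%d≡[m*n]%d N (a * c) k ⟩
      (a * c * k) % N         ≡⟨ cong (_% N) (regroup a c k) ⟩
      (c * (a * k)) % N       ≡⟨ sym ([m*n%d]%d≡[m*n]%d N c (a * k)) ⟩
      (c * ((a * k) % N)) % N ≡⟨ cong (λ x → (c * x) % N) (proj₂ k-invertible) ⟩
      (c * 1) % N             ≡⟨ cong (_% N) (*-identityʳ c) ⟩
      c % N                   ∎
      where
      regroup : ∀ a c k → a * c * k ≡ c * (a * k)
      regroup = solve-∀

  W-shift∋ᶜ : ∀ M d i → W ((M + d) % N) ∋ᶜ i ≡ window d (pos M i)
  W-shift∋ᶜ M d i = trans (W∋ᶜ _ i) (cong (λ x → N ≤ᵇ x + k) (begin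
      (i * k + (M + d) % N) % N ≡⟨ [m+n%d]%d≡[m+n]%d N (i * k) (M + d) ⟩
      (i * k + (M + d)) % N     ≡⟨ cong (_% N) (sym (+-assoc (i * k) M d)) ⟩
      (i * k + M + d) % N       ≡⟨ sym ([m%d+n]%d≡[m+n]%d N (i * k + M) d) ⟩
      (pos M i + d) % N         ∎))
    where open ≡-Reasoning

  W∋ᶜ-window : ∀ M i → M < N → W M ∋ᶜ i ≡ window 0 (pos M i)
  W∋ᶜ-window M i M<N = trans (cong (λ t → W t ∋ᶜ i) (sym (trans (cong (_% N) (+-identityʳ M)) (m<n⇒m%n≡m M<N))))
                             (W-shift∋ᶜ M 0 i)

  W-disjoint : ∀ M d → M < N → k ≤ d → d ≤ N ∸ k → disjointᵇ (W M) (W ((M + d) % N)) ≡ true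
  W-disjoint M d M<N k≤d d≤N∸k = disjointᵇ⁺ (W M) (W ((M + d) % N)) avoid
    where
    avoid : ∀ i → not (W M ∋ᶜ i ∧ W ((M + d) % N) ∋ᶜ i) ≡ true
    avoid i rewrite W∋ᶜ-window M i M<N | W-shift∋ᶜ M d i with window 0 (pos M i) in in₀
    ... | false = refl
    ... | true rewrite window-disjoint k≤d d≤N∸k (m%n<n (i * k + M) N) in₀ = refl

  -- i ↦ pos M i hits every residue, so overlapping windows force W M and its shift to meet.
  window-meet⇒¬disjoint : ∀ M d y → M < N → y < N → window 0 y ≡ true → window d y ≡ true →
                          disjointᵇ (W M) (W ((M + d) % N)) ≢ true
  window-meet⇒¬disjoint M d y M<N y<N in₀ in-d disj with pos-surjective M y (<⇒≤ M<N) y<N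
  ... | i , i<N , pos≡y = false≢true (begin
      false                                     ≡⟨⟩
      not (true ∧ true)                         ≡⟨ cong₂ (λ a b → not (a ∧ b)) (sym in₀) (sym in-d) ⟩
      not (window 0 y ∧ window d y)             ≡⟨ cong (λ x → not (window 0 x ∧ window d x)) (sym pos≡y) ⟩
      not (window 0 (pos M i) ∧ window d (pos M i))
        ≡⟨ sym (cong₂ (λ a b → not (a ∧ b)) (W∋ᶜ-window M i M<N) (W-shift∋ᶜ M d i)) ⟩
      not (W M ∋ᶜ i ∧ W ((M + d) % N) ∋ᶜ i)     ≡⟨ disjointᵇ⁻ (W M) (W ((M + d) % N)) disj i i<N ⟩
      true                                      ∎)
    where
    open ≡-Reasoning
    false≢true : false ≢ true
    false≢true ()

  W-disjoint⁻ : ∀ M d → M < N → d < N → disjointᵇ (W M) (W ((M + d) % N)) ≡ true → k ≤ d × d ≤ N ∸ k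
  W-disjoint⁻ M d M<N d<N disj = lower , upper
    where
    lower : k ≤ d
    lower with k ≤? d
    ... | yes k≤d = k≤d
    ... | no  k≰d with window-meet-low 0<k (≰⇒> k≰d)
    ...   | in₀ , in-d = ⊥-elim (window-meet⇒¬disjoint M d (N ∸ k) M<N (N∸k<N 0<k) in₀ in-d disj)
    upper : d ≤ N ∸ k
    upper with d ≤? N ∸ k
    ... | yes d≤N∸k = d≤N∸k
    ... | no  d≰N∸k with window-meet-high 0<k (≰⇒> d≰N∸k) d<N
    ...   | in₀ , in-d = ⊥-elim (window-meet⇒¬disjoint M d p M<N (n<1+n p) in₀ in-d disj)

  W-shift-separated : ∀ M d d′ → M < N → d < d′ → d′ ≤ N ∸ k → W ((M + d) % N) ≢ W ((M + d′) % N)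
  W-shift-separated M d d′ M<N d<d′ d′≤N∸k eq with pos-surjective M (p ∸ d) (<⇒≤ M<N) (s≤s (m∸n≤m p d))
  ... | i , _ , pos≡ with window-separates 0<k d<d′ d′≤N∸k
  ...   | in-d , out-d′ = true≢false (begin
      true                           ≡⟨ sym in-d ⟩
      window d (p ∸ d)               ≡⟨ cong (window d) (sym pos≡) ⟩
      window d (pos M i)             ≡⟨ sym (W-shift∋ᶜ M d i) ⟩
      W ((M + d) % N) ∋ᶜ i           ≡⟨ cong (_∋ᶜ i) eq ⟩
      W ((M + d′) % N) ∋ᶜ i          ≡⟨ W-shift∋ᶜ M d′ i ⟩
      window d′ (pos M i)            ≡⟨ cong (window d′) pos≡ ⟩
      window d′ (p ∸ d)              ≡⟨ out-d′ ⟩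
      false                          ∎)
    where
    open ≡-Reasoning
    true≢false : true ≢ false
    true≢false ()

  W-shift-injective : ∀ M d d′ → M < N → d ≤ N ∸ k → d′ ≤ N ∸ k → W ((M + d) % N) ≡ W ((M + d′) % N) → d ≡ d′
  W-shift-injective M d d′ M<N d≤ d′≤ eq with <-cmp d d′
  ... | tri< d<d′ _ _ = ⊥-elim (W-shift-separated M d d′ M<N d<d′ d′≤ eq)
  ... | tri≈ _ d≡d′ _ = d≡d′
  ... | tri> _ _ d′<d = ⊥-elim (W-shift-separated M d′ d M<N d′<d d≤ (sym eq))

  k+j≤N∸k : ∀ {j} → j < N ∸ 2 * k + 1 → k + j ≤ N ∸ k
  k+j≤N∸k {j} j<c = begin
    k + j             ≤⟨ +-monoʳ-≤ k (s≤s⁻¹ (subst (j <_) (+-comm (N ∸ 2 * k) 1) j<c)) ⟩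
    k + (N ∸ 2 * k)   ≡⟨ cong (λ x → k + (N ∸ x)) 2*k≡k+k ⟩
    k + (N ∸ (k + k)) ≡⟨ cong (k +_) (sym (∸-+-assoc N k k)) ⟩
    k + (N ∸ k ∸ k)   ≡⟨ m+[n∸m]≡n k≤N∸k ⟩
    N ∸ k             ∎
    where
    open ≤-Reasoning
    2*k≡k+k : 2 * k ≡ k + k
    2*k≡k+k = cong (k +_) (+-identityʳ k)

  d∸k<N∸2k+1 : ∀ {d} → d ≤ N ∸ k → d ∸ k < N ∸ 2 * k + 1
  d∸k<N∸2k+1 {d} d≤N∸k = subst (d ∸ k <_) (+-comm 1 (N ∸ 2 * k)) (s≤s (begin
    d ∸ k           ≤⟨ ∸-monoˡ-≤ k d≤N∸k ⟩
    N ∸ k ∸ k       ≡⟨ ∸-+-assoc N k k ⟩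
    N ∸ (k + k)     ≡⟨ cong (λ x → N ∸ (k + x)) (sym (+-identityʳ k)) ⟩
    N ∸ 2 * k       ∎))
    where open ≤-Reasoning

  degree-W : ∀ M → M < N → degreeQ N k (W M) ≡ N ∸ 2 * k + 1
  degree-W M M<N =
    trans (Unique∧⊆∧⊇⇒length≡ (filterᵇ adjacent (allSubsets N)) shifts
             (Unique.filter⁺ (T? ∘ adjacent) (allSubsets-unique N)) shifts-unique adjacent⊆shifts shifts⊆adjacent)
          (length-applyUpTo shift (N ∸ 2 * k + 1))
    where
    adjacent : Subset N → Bool
    adjacent V = isQVertexᵇ N k V ∧ disjointᵇ (W M) V
    shift : ℕ → Subset N
    shift j = W ((M + (k + j)) % N)
    shifts : List (Subset N)
    shifts = applyUpTo shift (N ∸ 2 * k + 1)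

    shifts-unique : Unique shifts
    shifts-unique = Unique.applyUpTo⁺₁ shift (N ∸ 2 * k + 1) λ {i} {j} i<j j<c eq →
      <⇒≢ i<j (+-cancelˡ-≡ k i j
        (W-shift-injective M (k + i) (k + j) M<N (k+j≤N∸k (<-trans i<j j<c)) (k+j≤N∸k j<c) eq))

    shifts⊆adjacent : shifts ⊆ filterᵇ adjacent (allSubsets N)
    shifts⊆adjacent V∈ with ∈-applyUpTo⁻ shift V∈
    ... | j , j<c , refl = ∈-filter⁺ (T? ∘ adjacent) (∈-allSubsets (shift j)) (≡true⇒T (∧-intro
          (W-isQVertex 2k≤N ((M + (k + j)) % N) (m%n<n (M + (k + j)) N))
          (W-disjoint M (k + j) M<N (m≤m+n k j) (k+j≤N∸k j<c))))

    adjacent⊆shifts : filterᵇ adjacent (allSubsets N) ⊆ shifts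
    adjacent⊆shifts {V} V∈ with ∈-filter⁻ (T? ∘ adjacent) {xs = allSubsets N} V∈
    ... | _ , adj = subst (_∈ shifts) (sym V≡shift) (∈-applyUpTo⁺ shift (d∸k<N∸2k+1 (proj₂ range)))
      where
      adj≡ : adjacent V ≡ true
      adj≡ = T⇒≡true {adjacent V} adj
      char : ∃ λ M′ → M′ < N × V ≡ W M′
      char = isQVertex⇒≡W p k k≤N coprime V (∧-conicalˡ (isQVertexᵇ N k V) _ adj≡)
      t : ℕ
      t = proj₁ char
      d : ℕ
      d = (t + (N ∸ M)) % N
      M+d≡t : (M + d) % N ≡ t
      M+d≡t = begin
        (M + (t + (N ∸ M)) % N) % N ≡⟨ [m+n%d]%d≡[m+n]%d N M (t + (N ∸ M)) ⟩
        (M + (t + (N ∸ M))) % N     ≡⟨ cong (_% N) (regroup M t (N ∸ M)) ⟩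
        (t + (N ∸ M + M)) % N       ≡⟨ cong (λ x → (t + x) % N) (m∸n+n≡m (<⇒≤ M<N)) ⟩
        (t + N) % N                 ≡⟨ [m+n]%n≡m%n t N ⟩
        t % N                       ≡⟨ m<n⇒m%n≡m (proj₁ (proj₂ char)) ⟩
        t                           ∎
        where
        open ≡-Reasoning
        regroup : ∀ a b c → a + (b + c) ≡ b + (c + a)
        regroup = solve-∀
      V≡W : V ≡ W ((M + d) % N)
      V≡W = trans (proj₂ (proj₂ char)) (cong W (sym M+d≡t))
      range : k ≤ d × d ≤ N ∸ k
      range = W-disjoint⁻ M d M<N (m%n<n (t + (N ∸ M)) N)
                (subst (λ U → disjointᵇ (W M) U ≡ true) V≡W (∧-conicalʳ (isQVertexᵇ N k V) _ adj≡))
      V≡shift : V ≡ shift (d ∸ k)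
      V≡shift = trans V≡W (cong (λ x → W ((M + x) % N)) (sym (m+[n∸m]≡n (proj₁ range))))

proposition20 : (n k : ℕ) → 0 < k → 2 * k < n → gcd n k ≡ 1 →
    (U : Subset n) → isQVertexᵇ n k U ≡ true →
    degreeQ n k U ≡ n ∸ 2 * k + 1
proposition20 zero    k 0<k () gcd≡1 U vertex
proposition20 (suc p) k 0<k 2k<n gcd≡1 U vertex =
  subst (λ V → degreeQ (suc p) k V ≡ suc p ∸ 2 * k + 1) (sym U≡W)
        (Neighbourhood.degree-W p k 0<k 2k≤n coprime M M<n)
  where
  coprime : Coprime (suc p) k
  coprime = gcd≡1⇒coprime gcd≡1
  2k≤n : k + k ≤ suc p
  2k≤n = subst (_≤ suc p) (cong (k +_) (+-identityʳ k)) (<⇒≤ 2k<n)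
  U-form : ∃ λ M → M < suc p × U ≡ Christoffel.W p k M
  U-form = isQVertex⇒≡W p k (≤-trans (m≤m+n k k) 2k≤n) coprime U vertex
  M : ℕ
  M = proj₁ U-form
  M<n : M < suc p
  M<n = proj₁ (proj₂ U-form)
  U≡W : U ≡ Christoffel.W p k M
  U≡W = proj₂ (proj₂ U-form)
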